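{- The only solutions of the equation $2^y(2^x-1)^z+1=(2^{x+1}-1)^w$ in integers $x\ge3$, $y\ge1$, $z\ge0$, $w\ge0$ are $(x,y,z,w)\in\{(x,x+2,1,2),(x,1,1,1)\}$ (with $x\ge3$ arbitrary). -}

module Defs where

{-# OPTIONS --safe #-}
-- Write a = 2^x - 1, b = 2a + 1 = 2^(x+1) - 1 and R_B(w) = 1 + B + ... + B^(w-1) (repunit B w), so
-- that b^w - 1 = 2a R_b(w) and the equation becomes 2^(y-1) a^(z-1) = R_b(w) (z = 0 is impossible as
-- a is odd and > 1). Since b ≡ 1 (mod a) and a is odd, lifting the exponent gives a^(z-1) ∣ w.
-- If w is odd then R_b(w) is odd, so y = 1 and R_b(w) = a^(z-1) divides w, forcing w = 1.
-- If w = 2m then R_b(w) = 2^(x+1) R_(b²)(m); lifting the exponent at 2, now for b² ≡ 1 (mod 4),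
-- shows that the 2-part of R_(b²)(m) divides m, and with a^(z-1) ∣ m the whole of R_(b²)(m)
-- divides m, forcing m = 1.
module Submission where

open import Defs
open import Data.Nat using (ℕ; _+_; _*_; _∸_; _^_; _≤_)
open import Data.Product using (_×_)
open import Data.Sum using (_⊎_)
open import Relation.Binary.PropositionalEquality using (_≡_)

open import Data.Nat using (zero; suc; _<_; z≤n; s≤s; NonZero; _≤?_)
open import Data.Nat.Properties
open import Data.Nat.Divisibility
open import Data.Nat.Coprimality using (Coprime; coprime-divisor) renaming (sym to coprime-sym)
open import Data.Nat.Tactic.RingSolver using (solve-∀)
open import Data.Product using (∃; _,_; map; map₁; map₂)
open import Data.Sum using (inj₁; inj₂) renaming (map to ⊎-map)
open import Data.Empty using (⊥-elim)
open import Relation.Nullary using (¬_; yes; no)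
open import Relation.Binary.PropositionalEquality using (refl; sym; trans; cong; subst; subst₂; module ≡-Reasoning)
open ≡-Reasoning

repunit : ℕ → ℕ → ℕ
repunit B zero    = 0
repunit B (suc w) = 1 + B * repunit B w

repunit-geometric : ∀ m w → m * repunit (1 + m) w + 1 ≡ (1 + m) ^ w
repunit-geometric m zero    = cong (_+ 1) (*-zeroʳ m)
repunit-geometric m (suc w) = begin
  m * (1 + (1 + m) * repunit (1 + m) w) + 1  ≡⟨ regroup m (repunit (1 + m) w) ⟩
  (1 + m) * (m * repunit (1 + m) w + 1)      ≡⟨ cong ((1 + m) *_) (repunit-geometric m w) ⟩
  (1 + m) * (1 + m) ^ w                      ∎
  where
  regroup : ∀ m r → m * (1 + (1 + m) * r) + 1 ≡ (1 + m) * (m * r + 1)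
  regroup = solve-∀

repunit-+ : ∀ B u v → repunit B (u + v) ≡ repunit B u + B ^ u * repunit B v
repunit-+ B zero    v = sym (*-identityˡ (repunit B v))
repunit-+ B (suc u) v = begin
  1 + B * repunit B (u + v)                      ≡⟨ cong (λ r → 1 + B * r) (repunit-+ B u v) ⟩
  1 + B * (repunit B u + B ^ u * repunit B v)    ≡⟨ regroup B (repunit B u) (B ^ u) (repunit B v) ⟩
  1 + B * repunit B u + B * B ^ u * repunit B v  ∎
  where
  regroup : ∀ B r p s → 1 + B * (r + p * s) ≡ 1 + B * r + B * p * s
  regroup = solve-∀

repunit-* : ∀ B n m → repunit B (n * m) ≡ repunit B n * repunit (B ^ n) m
repunit-* B n zero    = trans (cong (repunit B) (*-zeroʳ n)) (sym (*-zeroʳ (repunit B n)))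
repunit-* B n (suc m) = begin
  repunit B (n * suc m)                                ≡⟨ cong (repunit B) (*-suc n m) ⟩
  repunit B (n + n * m)                                ≡⟨ repunit-+ B n (n * m) ⟩
  repunit B n + B ^ n * repunit B (n * m)              ≡⟨ cong (λ r → repunit B n + B ^ n * r) (repunit-* B n m) ⟩
  repunit B n + B ^ n * (repunit B n * repunit (B ^ n) m) ≡⟨ regroup (repunit B n) (B ^ n) (repunit (B ^ n) m) ⟩
  repunit B n * (1 + B ^ n * repunit (B ^ n) m)        ∎
  where
  regroup : ∀ r p s → r + p * (r * s) ≡ r * (1 + p * s)
  regroup = solve-∀

repunit-even : ∀ B m → repunit B (2 * m) ≡ (1 + B) * repunit (B ^ 2) m
repunit-even B m = trans (repunit-* B 2 m) (cong (_* repunit (B ^ 2) m) (repunit-two B))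
  where
  repunit-two : ∀ B → 1 + B * (1 + B * 0) ≡ 1 + B
  repunit-two = solve-∀

repunit≡length-mod : ∀ d e w → ∃ λ t → repunit (1 + d * e) w ≡ w + d * t
repunit≡length-mod d e zero    = 0 , sym (*-zeroʳ d)
repunit≡length-mod d e (suc w) =
  let t , eq = repunit≡length-mod d e w in
  t + e * (w + d * t) , (begin
    1 + (1 + d * e) * repunit (1 + d * e) w  ≡⟨ cong (λ r → 1 + (1 + d * e) * r) eq ⟩
    1 + (1 + d * e) * (w + d * t)            ≡⟨ regroup d e w t ⟩
    suc w + d * (t + e * (w + d * t))        ∎)
  where
  regroup : ∀ d e w t → 1 + (1 + d * e) * (w + d * t) ≡ suc w + d * (t + e * (w + d * t))
  regroup = solve-∀

∣repunit⇒∣length : ∀ d e w → d ∣ repunit (1 + d * e) w → d ∣ w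
∣repunit⇒∣length d e w d∣R =
  let t , eq = repunit≡length-mod d e w in
  ∣m+n∣m⇒∣n (subst (d ∣_) (trans eq (+-comm w (d * t))) d∣R) (m∣m*n t)

triangle : ℕ → ℕ
triangle zero    = 0
triangle (suc w) = triangle w + w

triangle-odd : ∀ h → triangle (1 + 2 * h) ≡ (1 + 2 * h) * h
triangle-odd zero    = refl
triangle-odd (suc h) = begin
  triangle (1 + 2 * suc h)                          ≡⟨ cong triangle (regroup₁ h) ⟩
  triangle (1 + 2 * h) + (1 + 2 * h) + (2 + 2 * h)  ≡⟨ cong (λ t → t + (1 + 2 * h) + (2 + 2 * h)) (triangle-odd h) ⟩
  (1 + 2 * h) * h + (1 + 2 * h) + (2 + 2 * h)       ≡⟨ regroup₂ h ⟩
  (1 + 2 * suc h) * suc h                           ∎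
  where
  regroup₁ : ∀ h → 1 + 2 * suc h ≡ 3 + 2 * h
  regroup₁ = solve-∀
  regroup₂ : ∀ h → (1 + 2 * h) * h + (1 + 2 * h) + (2 + 2 * h) ≡ (1 + 2 * suc h) * suc h
  regroup₂ = solve-∀

repunit≡length+triangle-mod : ∀ n c w →
  ∃ λ t → repunit (1 + n * c) w ≡ w + n * c * triangle w + n * n * t
repunit≡length+triangle-mod n c zero    = 0 , regroup n c
  where
  regroup : ∀ n c → 0 ≡ 0 + n * c * 0 + n * n * 0
  regroup = solve-∀
repunit≡length+triangle-mod n c (suc w) =
  let t , eq = repunit≡length+triangle-mod n c w in
  t + c * c * triangle w + n * c * t ,
  trans (cong (λ r → 1 + (1 + n * c) * r) eq) (regroup n c w (triangle w) t)
  where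
  regroup : ∀ n c w T t → 1 + (1 + n * c) * (w + n * c * T + n * n * t)
            ≡ suc w + n * c * (T + w) + n * n * (t + c * c * T + n * c * t)
  regroup = solve-∀

LTECondition : ℕ → ℕ → Set
LTECondition n c = ∃ λ u → repunit (1 + n * c) n ≡ n + n * n * u

LTECondition-odd : ∀ h c → LTECondition (1 + 2 * h) c
LTECondition-odd h c =
  let t , eq = repunit≡length+triangle-mod n c n in
  c * h + t , (begin
    repunit (1 + n * c) n               ≡⟨ eq ⟩
    n + n * c * triangle n + n * n * t  ≡⟨ cong (λ s → n + n * c * s + n * n * t) (triangle-odd h) ⟩
    n + n * c * (n * h) + n * n * t     ≡⟨ regroup n c h t ⟩
    n + n * n * (c * h + t)             ∎)
  where
  n = 1 + 2 * h
  regroup : ∀ n c h t → n + n * c * (n * h) + n * n * t ≡ n + n * n * (c * h + t)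
  regroup = solve-∀

LTECondition-two : ∀ e → LTECondition 2 (2 * e)
LTECondition-two e = e , regroup e
  where
  regroup : ∀ e → 1 + (1 + 2 * (2 * e)) * (1 + (1 + 2 * (2 * e)) * 0) ≡ 2 + 2 * 2 * e
  regroup = solve-∀

LTECondition-^ : ∀ n c → LTECondition n c →
                 ∃ λ c′ → (1 + n * c) ^ n ≡ 1 + n * c′ × LTECondition n c′
LTECondition-^ n c (u , eq) = c * R , B^n≡ , condition
  where
  R = repunit (1 + n * c) n
  B^n≡ : (1 + n * c) ^ n ≡ 1 + n * (c * R)
  B^n≡ = trans (sym (repunit-geometric (n * c) n)) (regroup₁ n c R)
    where
    regroup₁ : ∀ n c r → n * c * r + 1 ≡ 1 + n * (c * r)
    regroup₁ = solve-∀
  n*c*R≡ : n * (c * R) ≡ n * n * (c * (1 + n * u))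
  n*c*R≡ = trans (cong (λ r → n * (c * r)) eq) (regroup₂ n c u)
    where
    regroup₂ : ∀ n c u → n * (c * (n + n * n * u)) ≡ n * n * (c * (1 + n * u))
    regroup₂ = solve-∀
  condition : LTECondition n (c * R)
  condition =
    let t , eq′ = repunit≡length-mod (n * n) (c * (1 + n * u)) n in
    t , trans (cong (λ s → repunit (1 + s) n) n*c*R≡) eq′

coprime-^ : ∀ {m n} k → Coprime m n → Coprime m (n ^ k)
coprime-^ zero    _   (_ , d∣1)     = ∣1⇒≡1 d∣1
coprime-^ (suc k) m⊥n (d∣m , d∣n^k) =
  coprime-^ k m⊥n (d∣m , coprime-divisor (λ (e∣d , e∣n) → m⊥n (∣-trans e∣d d∣m , e∣n)) d∣n^k)

coprime-1+* : ∀ n u → Coprime n (1 + n * u)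
coprime-1+* n u {d} (d∣n , d∣1+nu) =
  ∣1⇒≡1 (∣m+n∣m⇒∣n (subst (d ∣_) (+-comm 1 (n * u)) d∣1+nu) (∣m⇒∣m*n u d∣n))

coprime-*-∣ : ∀ {m n o} → Coprime m n → m ∣ o → n ∣ o → m * n ∣ o
coprime-*-∣ {m} {n} m⊥n (divides q refl) n∣q*m =
  subst (m * n ∣_) (*-comm m q)
    (*-monoʳ-∣ m (coprime-divisor (coprime-sym m⊥n) (subst (n ∣_) (*-comm q m) n∣q*m)))

-- Writing w = q n, R_B(q n) = R_B(n) R_{B^n}(q) where R_B(n) is n times a unit mod n, and B^n
-- satisfies the condition again, so one factor n of w is peeled off per step.
pow∣repunit⇒pow∣length : ∀ n .{{_ : NonZero n}} k c → LTECondition n c →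
                         ∀ w → n ^ k ∣ repunit (1 + n * c) w → n ^ k ∣ w
pow∣repunit⇒pow∣length n zero    c _ w _ = 1∣ w
pow∣repunit⇒pow∣length n (suc k) c condition@(u , eq) w n^[1+k]∣R
  with ∣repunit⇒∣length n c w (∣-trans (m∣m*n (n ^ k)) n^[1+k]∣R) | LTECondition-^ n c condition
... | divides q refl | c′ , B^n≡ , condition′ =
  subst (n * n ^ k ∣_) (*-comm n q) (*-monoʳ-∣ n n^k∣q)
  where
  T = repunit ((1 + n * c) ^ n) q
  R≡ : repunit (1 + n * c) (q * n) ≡ n * ((1 + n * u) * T)
  R≡ = begin
    repunit (1 + n * c) (q * n)          ≡⟨ cong (repunit (1 + n * c)) (*-comm q n) ⟩
    repunit (1 + n * c) (n * q)          ≡⟨ repunit-* (1 + n * c) n q ⟩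
    repunit (1 + n * c) n * T            ≡⟨ cong (_* T) eq ⟩
    (n + n * n * u) * T                  ≡⟨ regroup n u T ⟩
    n * ((1 + n * u) * T)                ∎
    where
    regroup : ∀ n u T → (n + n * n * u) * T ≡ n * ((1 + n * u) * T)
    regroup = solve-∀
  n^k∣T : n ^ k ∣ T
  n^k∣T = coprime-divisor (coprime-sym (coprime-^ k (coprime-sym (coprime-1+* n u))))
            (*-cancelˡ-∣ n (subst (n * n ^ k ∣_) R≡ n^[1+k]∣R))
  n^k∣q : n ^ k ∣ q
  n^k∣q = pow∣repunit⇒pow∣length n k c′ condition′ q (subst (λ B → n ^ k ∣ repunit B q) B^n≡ n^k∣T)

length<repunit : ∀ B w → 2 ≤ B → 2 + w < repunit B (2 + w)
length<repunit B@(suc _) w 2≤B =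
  s≤s (≤-trans 2+w≤2*[1+w] (*-mono-≤ 2≤B (length≤repunit (suc w))))
  where
  2+w≤2*[1+w] : 2 + w ≤ 2 * suc w
  2+w≤2*[1+w] = subst (2 + w ≤_) (sym (*-suc 2 w)) (+-monoʳ-≤ 2 (m≤n*m w 2))
  length≤repunit : ∀ w → w ≤ repunit B w
  length≤repunit zero    = z≤n
  length≤repunit (suc w) = s≤s (≤-trans (length≤repunit w) (m≤n*m (repunit B w) B))

repunit∣length⇒length≤1 : ∀ B w → 2 ≤ B → repunit B w ∣ w → w ≤ 1
repunit∣length⇒length≤1 B zero             _   _   = z≤n
repunit∣length⇒length≤1 B (suc zero)       _   _   = s≤s z≤n
repunit∣length⇒length≤1 B (suc (suc w)) 2≤B R∣w =
  ⊥-elim (<⇒≱ (length<repunit B w 2≤B) (∣⇒≤ R∣w))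

^≡1⇒exponent≡0 : ∀ {m n} → 1 < m → m ^ n ≡ 1 → n ≡ 0
^≡1⇒exponent≡0 {m} {n} 1<m eq with m^n≡1⇒n≡0∨m≡1 m n eq
... | inj₁ n≡0 = n≡0
... | inj₂ m≡1 = ⊥-elim (<⇒≢ 1<m (sym m≡1))

2∤1+2* : ∀ s → ¬ 2 ∣ 1 + 2 * s
2∤1+2* s 2∣1+2s with coprime-1+* 2 s (∣-refl , 2∣1+2s)
... | ()

even-or-odd : ∀ w → ∃ λ m → w ≡ 2 * m ⊎ w ≡ 1 + 2 * m
even-or-odd zero    = 0 , inj₁ refl
even-or-odd (suc w) with even-or-odd w
... | m , inj₁ w≡2m   = m , inj₂ (cong suc w≡2m)
... | m , inj₂ w≡1+2m = suc m , inj₁ (trans (cong suc w≡1+2m) (sym (*-suc 2 m)))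

2^[1+n]∸1≡1+2*[2^n∸1] : ∀ n → 2 ^ suc n ∸ 1 ≡ 1 + 2 * (2 ^ n ∸ 1)
2^[1+n]∸1≡1+2*[2^n∸1] n = double∸1 (m^n>0 2 n)
  where
  double∸1 : ∀ {p} → 1 ≤ p → 2 * p ∸ 1 ≡ 1 + 2 * (p ∸ 1)
  double∸1 {suc p} _ = cong (_∸ 1) (*-suc 2 p)

-- a = 2h + 1 and b = 2a + 1 stand for 2^x - 1 and 2^(x+1) - 1.
module Equation (h : ℕ) where

  a b : ℕ
  a = 1 + 2 * h
  b = 1 + a * 2

  2⊥a^k : ∀ k → Coprime 2 (a ^ k)
  2⊥a^k k = coprime-^ k (coprime-1+* 2 h)

  2∤a^k : ∀ k → ¬ 2 ∣ a ^ k
  2∤a^k k 2∣a^k with 2⊥a^k k (∣-refl , 2∣a^k)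
  ... | ()

  a^k∣repunit⇒a^k∣length : ∀ k w → a ^ k ∣ repunit b w → a ^ k ∣ w
  a^k∣repunit⇒a^k∣length k = pow∣repunit⇒pow∣length a k 2 (LTECondition-odd h 2)

  2^r∣repunit-b²⇒2^r∣length : ∀ r m → 2 ^ r ∣ repunit (b ^ 2) m → 2 ^ r ∣ m
  2^r∣repunit-b²⇒2^r∣length r m 2^r∣T =
    pow∣repunit⇒pow∣length 2 r (2 * (a * a + a)) (LTECondition-two (a * a + a)) m
      (subst (λ B → 2 ^ r ∣ repunit B m) (b² a) 2^r∣T)
    where
    b² : ∀ a → (1 + a * 2) * ((1 + a * 2) * 1) ≡ 1 + 2 * (2 * (a * a + a))
    b² = solve-∀

  repunit-b-even : ∀ m → repunit b (2 * m) ≡ 2 * (1 + a) * repunit (b ^ 2) m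
  repunit-b-even m = trans (repunit-even b m) (cong (_* repunit (b ^ 2) m) (1+b a))
    where
    1+b : ∀ a → 1 + (1 + a * 2) ≡ 2 * (1 + a)
    1+b = solve-∀

  2∤repunit-b-odd : ∀ m → ¬ 2 ∣ repunit b (1 + 2 * m)
  2∤repunit-b-odd m 2∣R = 2∤1+2* (b * ((1 + a) * T)) (subst (2 ∣_) R≡ 2∣R)
    where
    T = repunit (b ^ 2) m
    R≡ : 1 + b * repunit b (2 * m) ≡ 1 + 2 * (b * ((1 + a) * T))
    R≡ = trans (cong (λ r → 1 + b * r) (repunit-b-even m)) (regroup b (1 + a) T)
      where
      regroup : ∀ b c T → 1 + b * (2 * c * T) ≡ 1 + 2 * (b * (c * T))
      regroup = solve-∀

  a^k≡repunit⇒length≤1 : ∀ k w → a ^ k ≡ repunit b w → w ≤ 1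
  a^k≡repunit⇒length≤1 k w eq =
    repunit∣length⇒length≤1 b w (s≤s (s≤s z≤n))
      (subst (_∣ w) eq (a^k∣repunit⇒a^k∣length k w (∣-reflexive eq)))

  split-power-of-two : ∀ X v k T → 2 ^ v * a ^ k ≡ 2 ^ X * T →
                       ∃ λ r → v ≡ X + r × T ≡ 2 ^ r * a ^ k
  split-power-of-two X v k T eq with X ≤? v
  ... | yes X≤v with m≤n⇒∃[o]m+o≡n X≤v
  ...   | r , refl = r , refl , *-cancelˡ-≡ _ _ (2 ^ X) {{m^n≢0 2 X}} (begin
    2 ^ X * T                ≡⟨ sym eq ⟩
    2 ^ (X + r) * a ^ k      ≡⟨ cong (_* a ^ k) (^-distribˡ-+-* 2 X r) ⟩
    2 ^ X * 2 ^ r * a ^ k    ≡⟨ *-assoc (2 ^ X) (2 ^ r) (a ^ k) ⟩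
    2 ^ X * (2 ^ r * a ^ k)  ∎)
  split-power-of-two X v k T eq | no X≰v with m≤n⇒∃[o]m+o≡n (≰⇒> X≰v)
  ...   | o , refl = ⊥-elim (2∤a^k k (divides (2 ^ o * T) a^k≡))
    where
    a^k≡ : a ^ k ≡ 2 ^ o * T * 2
    a^k≡ = *-cancelˡ-≡ _ _ (2 ^ v) {{m^n≢0 2 v}} (begin
      2 ^ v * a ^ k                ≡⟨ eq ⟩
      2 * 2 ^ (v + o) * T          ≡⟨ cong (λ p → 2 * p * T) (^-distribˡ-+-* 2 v o) ⟩
      2 * (2 ^ v * 2 ^ o) * T      ≡⟨ regroup (2 ^ v) (2 ^ o) T ⟩
      2 ^ v * (2 ^ o * T * 2)      ∎)
      where
      regroup : ∀ p q T → 2 * (p * q) * T ≡ p * (q * T * 2)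
      regroup = solve-∀

  repunit-b²∣length : ∀ r k m → a ^ k ∣ 2 * m → repunit (b ^ 2) m ≡ 2 ^ r * a ^ k →
                      repunit (b ^ 2) m ∣ m
  repunit-b²∣length r k m a^k∣2m T≡ = subst (_∣ m) (sym T≡) (coprime-*-∣ 2^r⊥a^k 2^r∣m a^k∣m)
    where
    2^r⊥a^k : Coprime (2 ^ r) (a ^ k)
    2^r⊥a^k = coprime-sym (coprime-^ r (coprime-sym (2⊥a^k k)))
    2^r∣m : 2 ^ r ∣ m
    2^r∣m = 2^r∣repunit-b²⇒2^r∣length r m (subst (2 ^ r ∣_) (sym T≡) (m∣m*n (a ^ k)))
    a^k∣m : a ^ k ∣ m
    a^k∣m = coprime-divisor (coprime-sym (2⊥a^k k)) a^k∣2m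

  repunit-b²≡2^r*a^k⇒length≡1 : ∀ r k m → a ^ k ∣ 2 * m → repunit (b ^ 2) m ≡ 2 ^ r * a ^ k → m ≡ 1
  repunit-b²≡2^r*a^k⇒length≡1 r k zero _ T≡ =
    ⊥-elim (<⇒≢ (*-mono-≤ (m^n>0 2 r) (m^n>0 a k)) T≡)
  repunit-b²≡2^r*a^k⇒length≡1 r k (suc zero) _ _ = refl
  repunit-b²≡2^r*a^k⇒length≡1 r k m@(suc (suc _)) a^k∣2m T≡
    with repunit∣length⇒length≤1 (b ^ 2) m (s≤s (s≤s z≤n)) (repunit-b²∣length r k m a^k∣2m T≡)
  ... | s≤s ()

  solution⇒equation : ∀ {X} → 2 ^ X ≡ 2 * (1 + a) → ∀ v z w →
                      (v ≡ X × z ≡ 1 × w ≡ 2) ⊎ (v ≡ 0 × z ≡ 1 × w ≡ 1) →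
                      2 ^ suc v * a ^ z + 1 ≡ b ^ w
  solution⇒equation {X} 2^X≡ _ _ _ (inj₁ (refl , refl , refl)) = begin
    2 * 2 ^ X * (a * 1) + 1          ≡⟨ cong (λ p → 2 * p * (a * 1) + 1) 2^X≡ ⟩
    2 * (2 * (1 + a)) * (a * 1) + 1  ≡⟨ square a ⟩
    b * (b * 1)                      ∎
    where
    square : ∀ a → 2 * (2 * (1 + a)) * (a * 1) + 1 ≡ (1 + a * 2) * ((1 + a * 2) * 1)
    square = solve-∀
  solution⇒equation _ _ _ _ (inj₂ (refl , refl , refl)) = linear a
    where
    linear : ∀ a → 2 * 1 * (a * 1) + 1 ≡ (1 + a * 2) * 1
    linear = solve-∀

  module _ (1<a : 1 < a) where

    a∤2^j : ∀ j → ¬ a ∣ 2 ^ j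
    a∤2^j j a∣2^j = <⇒≢ 1<a (sym (coprime-^ j (coprime-sym (coprime-1+* 2 h)) (∣-refl , a∣2^j)))

    cancel-2a : ∀ v z w → 2 ^ suc v * a ^ z ≡ a * 2 * repunit b w →
                ∃ λ k → z ≡ suc k × 2 ^ v * a ^ k ≡ repunit b w
    cancel-2a v zero w eq =
      ⊥-elim (a∤2^j (suc v) (divides (2 * repunit b w)
        (trans (sym (*-identityʳ (2 ^ suc v))) (trans eq (regroup a (repunit b w))))))
      where
      regroup : ∀ a r → a * 2 * r ≡ 2 * r * a
      regroup = solve-∀
    cancel-2a v (suc k) w eq = k , refl , *-cancelˡ-≡ _ _ (a * 2) (trans (regroup a (2 ^ v) (a ^ k)) eq)
      where
      regroup : ∀ a p q → a * 2 * (p * q) ≡ 2 * p * (a * q)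
      regroup = solve-∀

    odd-length-solution : ∀ v k m → 2 ^ v * a ^ k ≡ repunit b (1 + 2 * m) → v ≡ 0 × k ≡ 0 × m ≡ 0
    odd-length-solution (suc v) k m eq =
      ⊥-elim (2∤repunit-b-odd m (divides (2 ^ v * a ^ k) (trans (sym eq) (regroup (2 ^ v) (a ^ k)))))
      where
      regroup : ∀ p q → 2 * p * q ≡ p * q * 2
      regroup = solve-∀
    odd-length-solution zero k zero eq =
      refl , ^≡1⇒exponent≡0 1<a (trans (sym (+-identityʳ (a ^ k))) (trans eq (cong suc (*-zeroʳ b)))) , refl
    odd-length-solution zero k (suc m) eq
      with a^k≡repunit⇒length≤1 k (1 + 2 * suc m) (trans (sym (+-identityʳ (a ^ k))) eq)
    ... | s≤s ()

    even-length-solution : ∀ {X} → 2 ^ X ≡ 2 * (1 + a) → ∀ v k m → 2 ^ v * a ^ k ≡ repunit b (2 * m) →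
                           v ≡ X × k ≡ 0 × m ≡ 1
    even-length-solution {X} 2^X≡ v k m eq
      with split-power-of-two X v k (repunit (b ^ 2) m)
             (trans eq (trans (repunit-b-even m) (cong (_* repunit (b ^ 2) m) (sym 2^X≡))))
    ... | r , refl , T≡
      with repunit-b²≡2^r*a^k⇒length≡1 r k m
             (a^k∣repunit⇒a^k∣length k (2 * m) (subst (a ^ k ∣_) eq (n∣m*n (2 ^ (X + r))))) T≡
    ... | refl =
      trans (cong (X +_) r≡0) (+-identityʳ X) , ^≡1⇒exponent≡0 1<a (m*n≡1⇒n≡1 (2 ^ r) (a ^ k) 2^r*a^k≡1) , refl
      where
      2^r*a^k≡1 : 2 ^ r * a ^ k ≡ 1
      2^r*a^k≡1 = trans (sym T≡) (cong suc (*-zeroʳ (b ^ 2)))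
      r≡0 : r ≡ 0
      r≡0 = ^≡1⇒exponent≡0 (s≤s (s≤s z≤n)) (m*n≡1⇒m≡1 (2 ^ r) (a ^ k) 2^r*a^k≡1)

    equation⇒solution : ∀ {X} → 2 ^ X ≡ 2 * (1 + a) → ∀ v z w → 2 ^ suc v * a ^ z + 1 ≡ b ^ w →
                        (v ≡ X × z ≡ 1 × w ≡ 2) ⊎ (v ≡ 0 × z ≡ 1 × w ≡ 1)
    equation⇒solution 2^X≡ v z w eq
      with cancel-2a v z w (+-cancelʳ-≡ 1 _ _ (trans eq (sym (repunit-geometric (a * 2) w))))
         | even-or-odd w
    ... | k , refl , eq′ | m , inj₁ refl =
      inj₁ (map₂ (map (cong suc) (cong (2 *_))) (even-length-solution 2^X≡ v k m eq′))
    ... | k , refl , eq′ | m , inj₂ refl =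
      inj₂ (map₂ (map (cong suc) (cong (λ m → 1 + 2 * m))) (odd-length-solution v k m eq′))

module Mersenne (n : ℕ) where

  open Equation (2 ^ n ∸ 1) public

  2^[1+n]∸1≡a : 2 ^ suc n ∸ 1 ≡ a
  2^[1+n]∸1≡a = 2^[1+n]∸1≡1+2*[2^n∸1] n

  2^[1+n+1]∸1≡b : 2 ^ (suc n + 1) ∸ 1 ≡ b
  2^[1+n+1]∸1≡b = begin
    2 ^ (suc n + 1) ∸ 1       ≡⟨ cong (λ m → 2 ^ m ∸ 1) (+-comm (suc n) 1) ⟩
    2 ^ suc (suc n) ∸ 1       ≡⟨ 2^[1+n]∸1≡1+2*[2^n∸1] (suc n) ⟩
    1 + 2 * (2 ^ suc n ∸ 1)   ≡⟨ cong (λ c → 1 + 2 * c) 2^[1+n]∸1≡a ⟩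
    1 + 2 * a                 ≡⟨ cong (1 +_) (*-comm 2 a) ⟩
    b                         ∎

  2^[2+n]≡2*[1+a] : 2 ^ suc (suc n) ≡ 2 * (1 + a)
  2^[2+n]≡2*[1+a] = cong (2 *_) (trans (sym (m+[n∸m]≡n (m^n>0 2 (suc n)))) (cong (1 +_) 2^[1+n]∸1≡a))

lemma4 : (x y z w : ℕ) → 3 ≤ x → 1 ≤ y →
    ((2 ^ y * (2 ^ x ∸ 1) ^ z + 1 ≡ (2 ^ (x + 1) ∸ 1) ^ w) →
    ((y ≡ x + 2 × z ≡ 1 × w ≡ 2) ⊎ (y ≡ 1 × z ≡ 1 × w ≡ 1)))
    × (((y ≡ x + 2 × z ≡ 1 × w ≡ 2) ⊎ (y ≡ 1 × z ≡ 1 × w ≡ 1)) →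
    2 ^ y * (2 ^ x ∸ 1) ^ z + 1 ≡ (2 ^ (x + 1) ∸ 1) ^ w)
lemma4 zero     _       _ _ ()  _
lemma4 (suc _)  zero    _ _ _   ()
lemma4 x@(suc n) (suc v) z w 3≤x _ = forward , backward
  where
  open Mersenne n
  1<a : 1 < a
  1<a = subst (1 <_) 2^[1+n]∸1≡a (≤-trans (s≤s (s≤s z≤n)) (∸-monoˡ-≤ 1 (^-monoʳ-≤ 2 3≤x)))
  forward : 2 ^ suc v * (2 ^ x ∸ 1) ^ z + 1 ≡ (2 ^ (x + 1) ∸ 1) ^ w →
            (suc v ≡ x + 2 × z ≡ 1 × w ≡ 2) ⊎ (suc v ≡ 1 × z ≡ 1 × w ≡ 1)
  forward eq =
    ⊎-map (map₁ (λ v≡1+x → trans (cong suc v≡1+x) (+-comm 2 x))) (map₁ (cong suc))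
      (equation⇒solution 1<a 2^[2+n]≡2*[1+a] v z w
        (subst₂ (λ A B → 2 ^ suc v * A ^ z + 1 ≡ B ^ w) 2^[1+n]∸1≡a 2^[1+n+1]∸1≡b eq))
  backward : (suc v ≡ x + 2 × z ≡ 1 × w ≡ 2) ⊎ (suc v ≡ 1 × z ≡ 1 × w ≡ 1) →
             2 ^ suc v * (2 ^ x ∸ 1) ^ z + 1 ≡ (2 ^ (x + 1) ∸ 1) ^ w
  backward solution =
    subst₂ (λ A B → 2 ^ suc v * A ^ z + 1 ≡ B ^ w) (sym 2^[1+n]∸1≡a) (sym 2^[1+n+1]∸1≡b)
      (solution⇒equation 2^[2+n]≡2*[1+a] v z w
        (⊎-map (map₁ (λ 1+v≡x+2 → suc-injective (trans 1+v≡x+2 (+-comm x 2)))) (map₁ suc-injective) solution))
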